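{- Let $X$ be a finite connected vertex-transitive graph with at least $3$ vertices, and let $G$ be a group of automorphisms of $X$ acting transitively on $V(X)$ such that $G'$ is cyclic of order $p^k$ for a prime $p$, and such that $X$ is $G$-minimal. If $H$ is a normal subgroup of $G$ with $H\subseteq \Phi(G)$, then for each $x\in V(X)$ the subgraph of $X$ induced by the $H$-orbit $Hx$ has no edges.
   Context: $G'$ is the commutator subgroup of $G$; $\Phi(G)$ is the Frattini subgroup (set of nongenerators) of $G$. $Hx = \{hx : h \in H\}$. $X$ is $G$-minimal if every connected spanning subgraph $Y$ of $X$ with $gY=Y$ for all $g\in G$ equals $X$. -}

module Defs where

open import Level using (Level; 0ℓ) renaming (suc to lsuc)
open import Data.Nat using (ℕ; zero; suc; _<_; _^_)
open import Data.Fin using (Fin)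
open import Data.Fin.Permutation using (Permutation′; _⟨$⟩ʳ_; id; flip; _∘ₚ_; _≈_)
open import Data.Nat.Primality using (Prime)
open import Data.Product using (Σ; ∃; ∃-syntax; _×_; _,_)
open import Data.Sum using (_⊎_)
open import Relation.Nullary using (¬_; Dec)
open import Relation.Binary.PropositionalEquality using (_≡_)

record Graph (n : ℕ) : Set₁ where
  field
    Adj    : Fin n → Fin n → Set
    sym    : ∀ {u v} → Adj u v → Adj v u
    irrefl : ∀ {u} → ¬ Adj u u
    dec    : ∀ u v → Dec (Adj u v)
open Graph public

data Path {n : ℕ} (E : Fin n → Fin n → Set) : Fin n → Fin n → Set where
  here : ∀ {u} → Path E u u
  step : ∀ {u v w} → E u v → Path E v w → Path E u w

ConnectedRel : {n : ℕ} → (Fin n → Fin n → Set) → Set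
ConnectedRel E = ∀ u v → Path E u v

Connected : {n : ℕ} → Graph n → Set
Connected X = ConnectedRel (Adj X)

-- Permutations of V(X) = Fin n; equality of permutations is pointwise (_≈_)

Perm : ℕ → Set
Perm = Permutation′

-- group product (g · h) x = g (h x)
_·_ : ∀ {n} → Perm n → Perm n → Perm n
g · h = h ∘ₚ g

_⁻¹ : ∀ {n} → Perm n → Perm n
g ⁻¹ = flip g

_^ₚ_ : ∀ {n} → Perm n → ℕ → Perm n
g ^ₚ zero  = id
g ^ₚ suc m = g · (g ^ₚ m)

⟦_,_⟧ : ∀ {n} → Perm n → Perm n → Perm n
⟦ a , b ⟧ = (a ⁻¹) · ((b ⁻¹) · (a · b))

PSet : ℕ → Set₁
PSet n = Perm n → Set

_⊆_ : ∀ {n} → PSet n → PSet n → Set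
S ⊆ T = ∀ g → S g → T g

record IsSubgroup {n : ℕ} (H : PSet n) : Set where
  field
    resp  : ∀ {g h} → g ≈ h → H g → H h
    one   : H id
    mul   : ∀ {g h} → H g → H h → H (g · h)
    inv   : ∀ {g} → H g → H (g ⁻¹)

IsAut : ∀ {n} → Graph n → Perm n → Set
IsAut X g = ∀ u v → (Adj X u v → Adj X (g ⟨$⟩ʳ u) (g ⟨$⟩ʳ v))
                   × (Adj X (g ⟨$⟩ʳ u) (g ⟨$⟩ʳ v) → Adj X u v)

IsAutGroup : ∀ {n} → Graph n → PSet n → Set
IsAutGroup X G = IsSubgroup G × (∀ g → G g → IsAut X g)

Transitive : ∀ {n} → PSet n → Set
Transitive {n} G = ∀ (u v : Fin n) → ∃[ g ] (G g × g ⟨$⟩ʳ u ≡ v)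

data ⟨_⟩ {n : ℕ} (S : PSet n) : PSet n where
  gen  : ∀ {g} → S g → ⟨ S ⟩ g
  one  : ⟨ S ⟩ id
  mul  : ∀ {g h} → ⟨ S ⟩ g → ⟨ S ⟩ h → ⟨ S ⟩ (g · h)
  inv  : ∀ {g} → ⟨ S ⟩ g → ⟨ S ⟩ (g ⁻¹)
  resp : ∀ {g h} → g ≈ h → ⟨ S ⟩ g → ⟨ S ⟩ h

Commutators : ∀ {n} → PSet n → PSet n
Commutators G c = ∃[ a ] ∃[ b ] (G a × G b × c ≈ ⟦ a , b ⟧)

Derived : ∀ {n} → PSet n → PSet n
Derived G = ⟨ Commutators G ⟩

CyclicOfOrder : ∀ {n} → PSet n → ℕ → Set
CyclicOfOrder H m =
  ∃[ c ] ( H c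
         × (∀ h → H h → ∃[ j ] (h ≈ (c ^ₚ j)))
         × ((c ^ₚ m) ≈ id)
         × (∀ j → 0 < j → j < m → ¬ ((c ^ₚ j) ≈ id)) )

_∪｛_｝ : ∀ {n} → PSet n → Perm n → PSet n
(S ∪｛ g ｝) h = S h ⊎ h ≈ g

-- Frattini subgroup Φ(G) as the set of nongenerators of G:
-- g ∈ G such that whenever S ⊆ G and ⟨S ∪ {g}⟩ = G, already ⟨S⟩ = G.
Frattini : ∀ {n} → PSet n → Perm n → Set₁
Frattini {n} G g =
  G g × (∀ (S : PSet n) → S ⊆ G → G ⊆ ⟨ S ∪｛ g ｝ ⟩ → G ⊆ ⟨ S ⟩)

IsNormalSubgroupOf : ∀ {n} → PSet n → PSet n → Set
IsNormalSubgroupOf H G =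
  IsSubgroup H × H ⊆ G × (∀ g h → G g → H h → H ((g ⁻¹) · (h · g)))

record SpanningSubgraph {n : ℕ} (X : Graph n) : Set₁ where
  field
    E    : Fin n → Fin n → Set
    sym  : ∀ {u v} → E u v → E v u
    sub  : ∀ {u v} → E u v → Adj X u v
open SpanningSubgraph public

Invariant : ∀ {n} {X : Graph n} → Perm n → SpanningSubgraph X → Set
Invariant g Y = ∀ u v → (E Y u v → E Y (g ⟨$⟩ʳ u) (g ⟨$⟩ʳ v))
                      × (E Y (g ⟨$⟩ʳ u) (g ⟨$⟩ʳ v) → E Y u v)

GMinimal : ∀ {n} → PSet n → Graph n → Set₁
GMinimal G X =
  ∀ (Y : SpanningSubgraph X) → ConnectedRel (E Y) → (∀ g → G g → Invariant g Y)
    → ∀ u v → Adj X u v → E Y u v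

-- Let Y be X with every edge inside an H-orbit deleted. Since H is normal in G, Y is
-- G-invariant. Walking along an X-path and translating by elements of H shows that every
-- vertex v has some translate h v (h ∈ H) joined to x in Y. Hence the elements of G that
-- move x inside its Y-component form a subgroup which, together with the finitely many
-- translating elements of H ⊆ Φ(G), generates G; as these are nongenerators, that subgroup
-- is all of G, so Y is connected by transitivity. G-minimality then forces Y = X, i.e. X
-- has no edge inside an H-orbit.
module Submission where

open import Defs
open import Data.Nat using (ℕ; _≤_; _^_; zero; suc)
open import Data.Fin using (Fin; zero; suc)
open import Data.Fin.Permutation using (_⟨$⟩ʳ_; _⟨$⟩ˡ_; _≈_; id; inverseˡ)
open import Data.Fin.Properties using (sequence)
open import Data.Nat.Primality using (Prime)
open import Data.Product using (∃-syntax; _×_; _,_; proj₁; proj₂)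
open import Data.Sum using (_⊎_; inj₁; inj₂)
open import Effect.Monad using (RawMonad)
open import Level using (0ℓ)
open import Relation.Nullary using (¬_)
open import Relation.Nullary.Decidable using (¬¬-excluded-middle; yes; no)
open import Relation.Nullary.Negation using (DoubleNegation; ¬¬-Monad)
open import Relation.Binary.PropositionalEquality using (_≡_; refl; trans; cong; subst)
  renaming (sym to ≡-sym)

open RawMonad (¬¬-Monad {a = 0ℓ}) using (rawApplicative; pure; _>>=_)

⟨⟩-mono : ∀ {n} {A B : PSet n} → A ⊆ B → ⟨ A ⟩ ⊆ ⟨ B ⟩
⟨⟩-mono A⊆B _ (gen a)    = gen (A⊆B _ a)
⟨⟩-mono A⊆B _ one        = one
⟨⟩-mono A⊆B _ (mul a b)  = mul (⟨⟩-mono A⊆B _ a) (⟨⟩-mono A⊆B _ b)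
⟨⟩-mono A⊆B _ (inv a)    = inv (⟨⟩-mono A⊆B _ a)
⟨⟩-mono A⊆B _ (resp e a) = resp e (⟨⟩-mono A⊆B _ a)

⟨⟩-least : ∀ {n} {S K : PSet n} → IsSubgroup K → S ⊆ K → ⟨ S ⟩ ⊆ K
⟨⟩-least K-sub S⊆K _ (gen s)    = S⊆K _ s
⟨⟩-least K-sub S⊆K _ one        = IsSubgroup.one K-sub
⟨⟩-least K-sub S⊆K _ (mul a b)  =
  IsSubgroup.mul K-sub (⟨⟩-least K-sub S⊆K _ a) (⟨⟩-least K-sub S⊆K _ b)
⟨⟩-least K-sub S⊆K _ (inv a)    = IsSubgroup.inv K-sub (⟨⟩-least K-sub S⊆K _ a)
⟨⟩-least K-sub S⊆K _ (resp e a) = IsSubgroup.resp K-sub e (⟨⟩-least K-sub S⊆K _ a)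

infixl 6 _∪ᶠ_
_∪ᶠ_ : ∀ {n m} → PSet n → (Fin m → Perm n) → PSet n
(S ∪ᶠ f) g = S g ⊎ ∃[ i ] (g ≈ f i)

≈-sym : ∀ {n} {g h : Perm n} → g ≈ h → h ≈ g
≈-sym g≈h i = ≡-sym (g≈h i)

Frattini-drop : ∀ {n} {G : PSet n} → IsSubgroup G → ∀ {m} (f : Fin m → Perm n)
  → (∀ i → Frattini G (f i)) → ∀ (S : PSet n) → S ⊆ G → G ⊆ ⟨ S ∪ᶠ f ⟩ → G ⊆ ⟨ S ⟩
Frattini-drop G-sub {zero} f Φf S S⊆G G⊆⟨S∪f⟩ g Gg = ⟨⟩-mono S∪f⊆S g (G⊆⟨S∪f⟩ g Gg)
  where
  S∪f⊆S : (S ∪ᶠ f) ⊆ S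
  S∪f⊆S _ (inj₁ s)       = s
  S∪f⊆S _ (inj₂ (() , _))
Frattini-drop {n} {G} G-sub {suc m} f Φf S S⊆G G⊆⟨S∪f⟩ =
  Frattini-drop G-sub (λ i → f (suc i)) (λ i → Φf (suc i)) S S⊆G
    (proj₂ (Φf zero) S′ S′⊆G (λ g Gg → ⟨⟩-mono regroup g (G⊆⟨S∪f⟩ g Gg)))
  where
  S′ : PSet n
  S′ = S ∪ᶠ (λ i → f (suc i))
  S′⊆G : S′ ⊆ G
  S′⊆G _ (inj₁ s)       = S⊆G _ s
  S′⊆G g (inj₂ (i , e)) =
    IsSubgroup.resp G-sub (≈-sym {g = g} {h = f (suc i)} e) (proj₁ (Φf (suc i)))
  regroup : (S ∪ᶠ f) ⊆ (S′ ∪｛ f zero ｝)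
  regroup _ (inj₁ s)             = inj₁ (inj₁ s)
  regroup _ (inj₂ (zero , e))    = inj₂ e
  regroup _ (inj₂ (suc i , e))   = inj₁ (inj₂ (i , e))

module _ {n : ℕ} {E : Fin n → Fin n → Set} where

  infixr 5 _++ₚ_
  _++ₚ_ : ∀ {u v w} → Path E u v → Path E v w → Path E u w
  here     ++ₚ q = q
  step e p ++ₚ q = step e (p ++ₚ q)

  Path-reverse : (∀ {u v} → E u v → E v u) → ∀ {u v} → Path E u v → Path E v u
  Path-reverse E-sym here       = here
  Path-reverse E-sym (step e p) = Path-reverse E-sym p ++ₚ step (E-sym e) here

  Path-map : (f : Fin n → Fin n) → (∀ {u v} → E u v → E (f u) (f v))
    → ∀ {u v} → Path E u v → Path E (f u) (f v)
  Path-map f f-hom here       = here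
  Path-map f f-hom (step e p) = step (f-hom e) (Path-map f f-hom p)

module _ {n : ℕ} {X : Graph n} {G : PSet n} (G-sub : IsSubgroup G)
  (Y : SpanningSubgraph X) (Y-inv : ∀ g → G g → Invariant g Y) where

  Path-translate : ∀ g → G g → ∀ {u v} → Path (E Y) u v → Path (E Y) (g ⟨$⟩ʳ u) (g ⟨$⟩ʳ v)
  Path-translate g Gg = Path-map (g ⟨$⟩ʳ_) (λ {u} {v} → proj₁ (Y-inv g Gg u v))

  Reaches : Fin n → PSet n
  Reaches x g = G g × Path (E Y) x (g ⟨$⟩ʳ x)

  Reaches-isSubgroup : ∀ x → IsSubgroup (Reaches x)
  Reaches-isSubgroup x = record
    { resp = λ { g≈h (Gg , p) → IsSubgroup.resp G-sub g≈h Gg , subst (Path (E Y) x) (g≈h x) p }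
    ; one  = IsSubgroup.one G-sub , here
    ; mul  = λ { {g} (Gg , p) (Gh , q) → IsSubgroup.mul G-sub Gg Gh , p ++ₚ Path-translate g Gg q }
    ; inv  = λ { {g} (Gg , p) → IsSubgroup.inv G-sub Gg , back g Gg p }
    }
    where
    back : ∀ g → G g → Path (E Y) x (g ⟨$⟩ʳ x) → Path (E Y) x (g ⟨$⟩ˡ x)
    back g Gg p = Path-reverse (SpanningSubgraph.sym Y)
      (subst (Path (E Y) (g ⟨$⟩ˡ x)) (inverseˡ g)
        (Path-translate (g ⁻¹) (IsSubgroup.inv G-sub Gg) p))

  -- Each g ∈ G is h⁻¹ (h g) with h ∈ H chosen so that h g x is Y-reachable from x.
  Frattini-translates⇒connected : Transitive G → ∀ {H : PSet n}
    → (∀ h → H h → Frattini G h)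
    → ∀ x → (∀ v → ∃[ h ] (H h × Path (E Y) x (h ⟨$⟩ʳ v)))
    → ConnectedRel (E Y)
  Frattini-translates⇒connected G-trans {H} Φ x reach u v =
    Path-reverse (SpanningSubgraph.sym Y) (from-x u) ++ₚ from-x v
    where
    translate : Fin n → Perm n
    translate v = proj₁ (reach v)

    G⊆⟨Reaches∪translates⟩ : G ⊆ ⟨ Reaches x ∪ᶠ translate ⟩
    G⊆⟨Reaches∪translates⟩ g Gg =
      resp {g = (h ⁻¹) · (h · g)} (λ _ → inverseˡ h)
        (mul {g = h ⁻¹} {h = h · g}
          (inv {g = h} (gen (inj₂ (g ⟨$⟩ʳ x , λ _ → refl))))
          (gen (inj₁ (IsSubgroup.mul G-sub (proj₁ (Φ h Hh)) Gg , p))))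
      where
      h : Perm n
      h = translate (g ⟨$⟩ʳ x)
      Hh : H h
      Hh = proj₁ (proj₂ (reach (g ⟨$⟩ʳ x)))
      p : Path (E Y) x (h ⟨$⟩ʳ (g ⟨$⟩ʳ x))
      p = proj₂ (proj₂ (reach (g ⟨$⟩ʳ x)))

    G⊆Reaches : G ⊆ Reaches x
    G⊆Reaches g Gg = ⟨⟩-least (Reaches-isSubgroup x) (λ _ r → r) g
      (Frattini-drop G-sub translate (λ v → Φ _ (proj₁ (proj₂ (reach v))))
        (Reaches x) (λ _ → proj₁) G⊆⟨Reaches∪translates⟩ g Gg)

    from-x : ∀ w → Path (E Y) x w
    from-x w with G-trans x w
    ... | g , Gg , gx≡w = subst (Path (E Y) x) gx≡w (proj₂ (G⊆Reaches g Gg))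

module _ {n : ℕ} {H : PSet n} (H-sub : IsSubgroup H) where

  SameOrbit : Fin n → Fin n → Set
  SameOrbit u w = ∃[ h ] (H h × h ⟨$⟩ʳ u ≡ w)

  SameOrbit-sym : ∀ {u w} → SameOrbit u w → SameOrbit w u
  SameOrbit-sym (h , Hh , hu≡w) =
    h ⁻¹ , IsSubgroup.inv H-sub Hh , trans (cong (h ⟨$⟩ˡ_) (≡-sym hu≡w)) (inverseˡ h)

  OrbitFree : (X : Graph n) → SpanningSubgraph X
  OrbitFree X = record
    { E   = λ u w → Adj X u w × ¬ SameOrbit u w
    ; sym = λ (a , ¬o) → Graph.sym X a , λ o → ¬o (SameOrbit-sym o)
    ; sub = proj₁
    }

OrbitFree-invariant : ∀ {n} {X : Graph n} {G H : PSet n} → IsAutGroup X G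
  → (H-normal : IsNormalSubgroupOf H G) → ∀ g → G g → Invariant g (OrbitFree (proj₁ H-normal) X)
OrbitFree-invariant (G-sub , G-aut) (H-sub , H⊆G , H-conj) g Gg u w =
  (λ (a , ¬o) → proj₁ (G-aut g Gg u w) a , λ o → ¬o (conjugate-back o)) ,
  (λ (a , ¬o) → proj₂ (G-aut g Gg u w) a , λ o → ¬o (conjugate-forth o))
  where
  conjugate-back : SameOrbit H-sub (g ⟨$⟩ʳ u) (g ⟨$⟩ʳ w) → SameOrbit H-sub u w
  conjugate-back (h , Hh , e) =
    (g ⁻¹) · (h · g) , H-conj g h Gg Hh , trans (cong (g ⟨$⟩ˡ_) e) (inverseˡ g)
  conjugate-forth : SameOrbit H-sub u w → SameOrbit H-sub (g ⟨$⟩ʳ u) (g ⟨$⟩ʳ w)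
  conjugate-forth (h , Hh , e) =
    ((g ⁻¹) ⁻¹) · (h · (g ⁻¹)) , H-conj (g ⁻¹) h (IsSubgroup.inv G-sub Gg) Hh ,
    cong (g ⟨$⟩ʳ_) (trans (cong (h ⟨$⟩ʳ_) (inverseˡ g)) e)

-- Whether an X-edge lies inside an H-orbit is not decidable, hence the double negation.
OrbitFree-reaches-translates : ∀ {n} {X : Graph n} {G H : PSet n} → Connected X
  → IsAutGroup X G → (H-normal : IsNormalSubgroupOf H G)
  → ∀ x v → DoubleNegation (∃[ h ] (H h × Path (E (OrbitFree (proj₁ H-normal) X)) x (h ⟨$⟩ʳ v)))
OrbitFree-reaches-translates {n} {X} {G} {H} X-conn G-aut H-normal@(H-sub , H⊆G , _) x v =
  reach-back (X-conn v x) (pure (id , IsSubgroup.one H-sub , here))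
  where
  Y : SpanningSubgraph X
  Y = OrbitFree H-sub X

  Y-inv : ∀ g → G g → Invariant g Y
  Y-inv = OrbitFree-invariant {X = X} G-aut H-normal

  ReachedUpTo : Fin n → Set
  ReachedUpTo v = ∃[ h ] (H h × Path (E Y) x (h ⟨$⟩ʳ v))

  across : ∀ {a b} → Adj X a b → ReachedUpTo a → DoubleNegation (ReachedUpTo b)
  across {a} {b} a~b (h , Hh , p) = ¬¬-excluded-middle {A = SameOrbit H-sub a b} >>= λ where
    (yes (h′ , Hh′ , h′a≡b)) → pure
      ( h · (h′ ⁻¹) , IsSubgroup.mul H-sub Hh (IsSubgroup.inv H-sub Hh′)
      , subst (λ z → Path (E Y) x (h ⟨$⟩ʳ z))
              (trans (≡-sym (inverseˡ h′)) (cong (h′ ⟨$⟩ˡ_) h′a≡b)) p )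
    (no ¬o) → pure
      ( h , Hh
      , p ++ₚ step (proj₁ (Y-inv h (H⊆G h Hh) a b) (a~b , ¬o)) here )

  reach-back : ∀ {u w} → Path (Adj X) u w
    → DoubleNegation (ReachedUpTo w) → DoubleNegation (ReachedUpTo u)
  reach-back here       r = r
  reach-back (step e p) r = reach-back p r >>= across (Graph.sym X e)

corollary3p6 : ∀ (n : ℕ) (X : Graph n) (G : PSet n) (p k : ℕ) (H : PSet n)
    → 3 ≤ n
    → Connected X
    → IsAutGroup X G
    → Transitive G
    → Prime p
    → CyclicOfOrder (Derived G) (p ^ k)
    → GMinimal G X
    → IsNormalSubgroupOf H G
    → (∀ h → H h → Frattini G h)
    → ∀ (x : Fin n) (h₁ h₂ : Perm n) → H h₁ → H h₂
    → ¬ Adj X (h₁ ⟨$⟩ʳ x) (h₂ ⟨$⟩ʳ x)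
corollary3p6 n X G p k H _ X-conn G-aut G-trans _ _ G-min H-normal@(H-sub , _) H⊆Φ
             x h₁ h₂ Hh₁ Hh₂ h₁x~h₂x =
  sequence rawApplicative (OrbitFree-reaches-translates {X = X} X-conn G-aut H-normal x) λ reach →
    proj₂ (G-min Y (Y-connected reach) Y-inv _ _ h₁x~h₂x) same-orbit
  where
  Y : SpanningSubgraph X
  Y = OrbitFree H-sub X
  Y-inv : ∀ g → G g → Invariant g Y
  Y-inv = OrbitFree-invariant {X = X} G-aut H-normal
  Y-connected : (∀ v → ∃[ h ] (H h × Path (E Y) x (h ⟨$⟩ʳ v))) → ConnectedRel (E Y)
  Y-connected = Frattini-translates⇒connected (proj₁ G-aut) Y Y-inv G-trans H⊆Φ x
  same-orbit : SameOrbit H-sub (h₁ ⟨$⟩ʳ x) (h₂ ⟨$⟩ʳ x)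
  same-orbit = h₂ · (h₁ ⁻¹) , IsSubgroup.mul H-sub Hh₂ (IsSubgroup.inv H-sub Hh₁)
             , cong (h₂ ⟨$⟩ʳ_) (inverseˡ h₁)
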